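{- Let $n,m$ be positive integers. If an $n\times m$ binary matrix $A$ is canonical, then it is semi-canonical.
   Context: A binary matrix is a matrix with entries in $\{0,1\}$. For an $n\times m$ binary matrix $A=[a_{ij}]$, let $r(A)=\langle x_1,\dots,x_n\rangle$ where $x_i$ is the natural number whose binary representation is $a_{i1}a_{i2}\cdots a_{im}$ (so $a_{i1}$ is the most significant bit), and let $c(A)=\langle y_1,\dots,y_m\rangle$ where $y_j$ is the natural number whose binary representation is $a_{1j}a_{2j}\cdots a_{nj}$. The matrix $A$ is called semi-canonical if $x_1\le\dots\le x_n$ and $y_1\le\dots\le y_m$. Two $n\times m$ binary matrices $A,B$ are equivalent, $A\sim B$, if $A=XBY$ for some $n\times n$ permutation matrix $X$ and some $m\times m$ permutation matrix $Y$ (i.e. $A$ is obtained from $B$ by permuting rows and columns). The matrix $A$ is called canonical if $r(A)$ is the minimal element, with respect to the lexicographic order on $n$-tuples of integers, of the set $\{r(B)\mid B\sim A\}$. -}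

module Defs where

open import Data.Nat using (ℕ; zero; suc; _+_; _*_; _≤_; _<_)
open import Data.Bool using (Bool; true; false)
open import Data.Fin using (Fin; zero; suc; inject₁; fromℕ)
open import Data.Fin.Permutation using (Permutation′; _⟨$⟩ʳ_)
open import Data.Product using (Σ; ∃; _×_; _,_)
open import Data.Sum using (_⊎_)
open import Relation.Binary.PropositionalEquality using (_≡_)

BinMatrix : ℕ → ℕ → Set
BinMatrix n m = Fin n → Fin m → Bool

bit : Bool → ℕ
bit false = 0
bit true  = 1

-- Natural number with binary representation b₀ b₁ … b_{k-1}
-- (b₀ = b zero is the most significant bit).
fromBits : (k : ℕ) → (Fin k → Bool) → ℕ
fromBits zero    b = 0
fromBits (suc k) b = fromBits k (λ i → b (inject₁ i)) * 2 + bit (b (fromℕ k))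

r : ∀ {n m} → BinMatrix n m → Fin n → ℕ
r {n} {m} A i = fromBits m (λ j → A i j)

c : ∀ {n m} → BinMatrix n m → Fin m → ℕ
c {n} {m} A j = fromBits n (λ i → A i j)

NonDecreasing : ∀ {k} → (Fin k → ℕ) → Set
NonDecreasing {k} x = ∀ (i j : Fin k) → Data.Fin._≤_ i j → x i ≤ x j

SemiCanonical : ∀ {n m} → BinMatrix n m → Set
SemiCanonical A = NonDecreasing (r A) × NonDecreasing (c A)

-- A ∼ B : A = X B Y for permutation matrices X, Y, i.e. A is obtained
-- from B by permuting rows (σ) and columns (τ).
_∼_ : ∀ {n m} → BinMatrix n m → BinMatrix n m → Set
_∼_ {n} {m} A B =
  Σ (Permutation′ n) λ σ → Σ (Permutation′ m) λ τ →
    ∀ i j → A i j ≡ B (σ ⟨$⟩ʳ i) (τ ⟨$⟩ʳ j)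

_≤lex_ : ∀ {k} → (Fin k → ℕ) → (Fin k → ℕ) → Set
_≤lex_ {zero}  x y = Data.Unit.⊤ where import Data.Unit
_≤lex_ {suc k} x y =
  x zero < y zero ⊎ (x zero ≡ y zero × (λ i → x (suc i)) ≤lex (λ i → y (suc i)))

-- A is canonical: r(A) is the least (= minimal, the order being total)
-- element of { r(B) | B ∼ A } in lexicographic order.
Canonical : ∀ {n m} → BinMatrix n m → Set
Canonical A = ∀ B → B ∼ A → r A ≤lex r B

-- Swapping two rows that are out of order, or two columns that are out of
-- order, produces an equivalent matrix whose row tuple is lexicographically
-- smaller.  For columns j < k with c(A)ⱼ > c(A)ₖ,
-- look at the first row t where the two columns differ: there column j has
-- a 1 and column k a 0, so the swap leaves rows above t unchanged and turns
-- the bit in position j of row t from 1 into 0, which decreases x_t.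
module Submission where

open import Defs
open import Data.Nat using (ℕ; NonZero; zero; suc; _+_; _*_; z≤n; s≤s)
import Data.Nat as ℕ
import Data.Nat.Properties as ℕ
open import Data.Bool using (Bool; true; false) renaming (_≟_ to _≟ᵇ_)
open import Data.Fin using (Fin; zero; suc; inject₁; fromℕ; _≟_)
import Data.Fin as F
import Data.Fin.Properties as F
open import Data.Fin.Permutation using (transpose; id)
import Data.Fin.Permutation.Components as PC
open import Data.Product using (∃; _×_; _,_)
open import Data.Sum using (_⊎_; inj₁; inj₂)
open import Function using (_∘_)
open import Relation.Nullary using (¬_; Dec; yes; no; contradiction)
open import Relation.Nullary.Decidable using (dec-true; dec-false)
open import Relation.Binary.PropositionalEquality

private
  variable
    k n m : ℕ
    A : Set

AgreeBelow : Fin k → (Fin k → A) → (Fin k → A) → Set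
AgreeBelow t x y = ∀ i → i F.< t → x i ≡ y i

transpose-matchˡ : (i j : Fin k) → PC.transpose i j i ≡ j
transpose-matchˡ i j rewrite dec-true (i ≟ i) refl = refl

transpose-matchʳ : (i j : Fin k) → PC.transpose i j j ≡ i
transpose-matchʳ i j with j ≟ i
... | yes refl = refl
... | no _ rewrite dec-true (j ≟ j) refl = refl

transpose-mismatch : (i j l : Fin k) → l ≢ i → l ≢ j → PC.transpose i j l ≡ l
transpose-mismatch i j l l≢i l≢j rewrite dec-false (l ≟ i) l≢i | dec-false (l ≟ j) l≢j = refl

transpose-fixes-below : {i j l : Fin k} → i F.< j → l F.< i → PC.transpose i j l ≡ l
transpose-fixes-below i<j l<i =
  transpose-mismatch _ _ _ (F.<⇒≢ l<i) (F.<⇒≢ (F.<-trans l<i i<j))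

transpose-equal-entries : (b : Fin k → A) {i j : Fin k} → b i ≡ b j →
                          ∀ l → b (PC.transpose i j l) ≡ b l
transpose-equal-entries b {i} {j} bi≡bj l = by-cases (l ≟ i) (l ≟ j)
  where
  by-cases : Dec (l ≡ i) → Dec (l ≡ j) → b (PC.transpose i j l) ≡ b l
  by-cases (yes refl) _          = trans (cong b (transpose-matchˡ i j)) (sym bi≡bj)
  by-cases (no _)     (yes refl) = trans (cong b (transpose-matchʳ i j)) bi≡bj
  by-cases (no l≢i)   (no l≢j)   = cong b (transpose-mismatch i j l l≢i l≢j)

agreeBelow∧>⇒≰lex : (x y : Fin k → ℕ) (t : Fin k) →
                    AgreeBelow t x y → y t ℕ.< x t → ¬ x ≤lex y
agreeBelow∧>⇒≰lex {suc k} x y zero    _     y<x (inj₁ x<y)      = ℕ.<-asym x<y y<x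
agreeBelow∧>⇒≰lex {suc k} x y zero    _     y<x (inj₂ (x≡y , _)) = ℕ.<-irrefl (sym x≡y) y<x
agreeBelow∧>⇒≰lex {suc k} x y (suc t) agree _   (inj₁ x<y)      = ℕ.<-irrefl (agree zero ℕ.z<s) x<y
agreeBelow∧>⇒≰lex {suc k} x y (suc t) agree y<x (inj₂ (_ , x≤y)) =
  agreeBelow∧>⇒≰lex (x ∘ suc) (y ∘ suc) t (λ i i<t → agree (suc i) (s≤s i<t)) y<x x≤y

transpose-descent⇒≰lex : (x : Fin k → ℕ) {i j : Fin k} →
                         i F.< j → x j ℕ.< x i → ¬ x ≤lex (x ∘ PC.transpose i j)
transpose-descent⇒≰lex x {i} {j} i<j xj<xi =
  agreeBelow∧>⇒≰lex x (x ∘ PC.transpose i j) i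
    (λ l l<i → cong x (sym (transpose-fixes-below i<j l<i)))
    (subst (λ l → x l ℕ.< x i) (sym (transpose-matchˡ i j)) xj<xi)

fromBits-cong : (b b′ : Fin k → Bool) → (∀ i → b i ≡ b′ i) → fromBits k b ≡ fromBits k b′
fromBits-cong {zero}  b b′ b≗b′ = refl
fromBits-cong {suc k} b b′ b≗b′ =
  cong₂ (λ u v → u * 2 + bit v) (fromBits-cong _ _ (b≗b′ ∘ inject₁)) (b≗b′ (fromℕ k))

fromℕ-or-inject₁ : (p : Fin (suc k)) → p ≡ fromℕ k ⊎ ∃ λ q → p ≡ inject₁ q
fromℕ-or-inject₁ {zero}  zero    = inj₁ refl
fromℕ-or-inject₁ {suc k} zero    = inj₂ (zero , refl)
fromℕ-or-inject₁ {suc k} (suc p) with fromℕ-or-inject₁ p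
... | inj₁ p≡last       = inj₁ (cong suc p≡last)
... | inj₂ (q , p≡q)    = inj₂ (suc q , cong suc p≡q)

bit<2 : ∀ v → bit v ℕ.< 2
bit<2 false = s≤s z≤n
bit<2 true  = s≤s (s≤s z≤n)

*2+bit-monoˡ-< : ∀ {a a′} u v → a′ ℕ.< a → a′ * 2 + bit u ℕ.< a * 2 + bit v
*2+bit-monoˡ-< {a} {a′} u v a′<a = begin-strict
  a′ * 2 + bit u  <⟨ ℕ.+-monoʳ-< (a′ * 2) (bit<2 u) ⟩
  a′ * 2 + 2      ≡⟨ ℕ.+-comm (a′ * 2) 2 ⟩
  suc a′ * 2      ≤⟨ ℕ.*-monoˡ-≤ 2 a′<a ⟩
  a * 2           ≤⟨ ℕ.m≤m+n (a * 2) (bit v) ⟩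
  a * 2 + bit v   ∎
  where open ℕ.≤-Reasoning

inject₁-mono-< : {i j : Fin k} → i F.< j → inject₁ i F.< inject₁ j
inject₁-mono-< {i = i} {j} = subst₂ ℕ._<_ (sym (F.toℕ-inject₁ i)) (sym (F.toℕ-inject₁ j))

inject₁<fromℕ : (i : Fin k) → inject₁ i F.< fromℕ k
inject₁<fromℕ {k} i = subst (F.toℕ (inject₁ i) ℕ.<_) (sym (F.toℕ-fromℕ k)) (F.inject₁ℕ< i)

-- fromBits peels off the least significant bit, so the induction splits on
-- whether the leading differing bit is the last one.
fromBits-< : (b b′ : Fin k → Bool) (p : Fin k) → AgreeBelow p b′ b →
             b′ p ≡ false → b p ≡ true → fromBits k b′ ℕ.< fromBits k b
fromBits-< {suc k} b b′ p agree b′p≡0 bp≡1 with fromℕ-or-inject₁ p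
... | inj₁ refl = begin-strict
  fromBits k (b′ ∘ inject₁) * 2 + bit (b′ (fromℕ k))
    ≡⟨ cong₂ (λ u v → u * 2 + bit v) prefix≡ b′p≡0 ⟩
  fromBits k (b ∘ inject₁) * 2 + 0
    <⟨ ℕ.+-monoʳ-< (fromBits k (b ∘ inject₁) * 2) (s≤s z≤n) ⟩
  fromBits k (b ∘ inject₁) * 2 + 1
    ≡⟨ cong (λ v → fromBits k (b ∘ inject₁) * 2 + bit v) (sym bp≡1) ⟩
  fromBits (suc k) b ∎
  where
  open ℕ.≤-Reasoning
  prefix≡ : fromBits k (b′ ∘ inject₁) ≡ fromBits k (b ∘ inject₁)
  prefix≡ = fromBits-cong _ _ (λ i → agree (inject₁ i) (inject₁<fromℕ i))
... | inj₂ (q , refl) =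
  *2+bit-monoˡ-< _ _
    (fromBits-< (b ∘ inject₁) (b′ ∘ inject₁) q
      (λ i i<q → agree (inject₁ i) (inject₁-mono-< i<q)) b′p≡0 bp≡1)

transpose-descent⇒fromBits-< : (b : Fin k → Bool) {i j : Fin k} → i F.< j →
                               b i ≡ true → b j ≡ false →
                               fromBits k (b ∘ PC.transpose i j) ℕ.< fromBits k b
transpose-descent⇒fromBits-< b {i} {j} i<j bi≡1 bj≡0 =
  fromBits-< b (b ∘ PC.transpose i j) i
    (λ l l<i → cong b (transpose-fixes-below i<j l<i))
    (trans (cong b (transpose-matchˡ i j)) bj≡0) bi≡1

firstDifference : (u v : Fin k → Bool) →
                  (∀ i → u i ≡ v i) ⊎ ∃ λ t → u t ≢ v t × AgreeBelow t u v
firstDifference {zero}  u v = inj₁ λ ()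
firstDifference {suc k} u v with u zero ≟ᵇ v zero
... | no u₀≢v₀ = inj₂ (zero , u₀≢v₀ , λ _ ())
... | yes u₀≡v₀ with firstDifference (u ∘ suc) (v ∘ suc)
...   | inj₁ u≗v               = inj₁ λ { zero → u₀≡v₀ ; (suc i) → u≗v i }
...   | inj₂ (t , uₜ≢vₜ , agree) =
  inj₂ (suc t , uₜ≢vₜ , λ { zero _ → u₀≡v₀ ; (suc i) (s≤s i<t) → agree i i<t })

fromBits-<⇒leadingDifference : (b b′ : Fin k → Bool) → fromBits k b′ ℕ.< fromBits k b →
                               ∃ λ t → AgreeBelow t b′ b × b′ t ≡ false × b t ≡ true
fromBits-<⇒leadingDifference b b′ b′<b with firstDifference b′ b
... | inj₁ b′≗b = contradiction (fromBits-cong b′ b b′≗b) (ℕ.<⇒≢ b′<b)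
... | inj₂ (t , b′ₜ≢bₜ , agree) with b′ t in b′ₜ | b t in bₜ
...   | false | true  = t , agree , b′ₜ , bₜ
...   | false | false = contradiction refl b′ₜ≢bₜ
...   | true  | true  = contradiction refl b′ₜ≢bₜ
...   | true  | false =
  contradiction b′<b (ℕ.<-asym (fromBits-< b′ b t (λ i i<t → sym (agree i i<t)) bₜ b′ₜ))

swapRows : Fin n → Fin n → BinMatrix n m → BinMatrix n m
swapRows i j A a b = A (PC.transpose i j a) b

swapCols : Fin m → Fin m → BinMatrix n m → BinMatrix n m
swapCols i j A a b = A a (PC.transpose i j b)

swapRows-∼ : (i j : Fin n) (A : BinMatrix n m) → swapRows i j A ∼ A
swapRows-∼ i j A = transpose i j , id , λ _ _ → refl

swapCols-∼ : (i j : Fin m) (A : BinMatrix n m) → swapCols i j A ∼ A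
swapCols-∼ i j A = id , transpose i j , λ _ _ → refl

canonical⇒rows-nonDecreasing : (A : BinMatrix n m) → Canonical A → NonDecreasing (r A)
canonical⇒rows-nonDecreasing A can i j i≤j = ℕ.≮⇒≥ λ xⱼ<xᵢ →
  let i<j = F.≤∧≢⇒< i≤j (λ { refl → ℕ.<-irrefl refl xⱼ<xᵢ }) in
  transpose-descent⇒≰lex (r A) i<j xⱼ<xᵢ (can _ (swapRows-∼ i j A))

canonical⇒cols-nonDecreasing : (A : BinMatrix n m) → Canonical A → NonDecreasing (c A)
canonical⇒cols-nonDecreasing A can j k j≤k = ℕ.≮⇒≥ λ yₖ<yⱼ →
  let j<k                        = F.≤∧≢⇒< j≤k (λ { refl → ℕ.<-irrefl refl yₖ<yⱼ })
      t , agree , Aₜₖ≡0 , Aₜⱼ≡1 = fromBits-<⇒leadingDifference _ _ yₖ<yⱼ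
      rowsAbove≡ : AgreeBelow t (r A) (r (swapCols j k A))
      rowsAbove≡ a a<t = sym (fromBits-cong _ _
        (transpose-equal-entries (A a) (sym (agree a a<t))))
  in agreeBelow∧>⇒≰lex (r A) (r (swapCols j k A)) t rowsAbove≡
       (transpose-descent⇒fromBits-< (A t) j<k Aₜⱼ≡1 Aₜₖ≡0)
       (can _ (swapCols-∼ j k A))

corollary2 : (n m : ℕ) → .{{_ : NonZero n}} → .{{_ : NonZero m}} →
    (A : BinMatrix n m) → Canonical A → SemiCanonical A
corollary2 n m A can =
  canonical⇒rows-nonDecreasing A can , canonical⇒cols-nonDecreasing A can
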